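{- Let $P$ be a finite bounded poset with an interpolating EL-labelling, and let $\hat0=x_0\lessdot x_1\lessdot\cdots\lessdot x_n=\hat1$ be the increasing chain from $\hat0$ to $\hat1$. For every $z\in P$, the sequence $\hat0=x_0\wedge z\le x_1\wedge z\le\cdots\le x_n\wedge z=z$, after deleting repeated elements, is the increasing chain from $\hat0$ to $z$. Consequently, $(x_i\wedge z)\vee^z y$ is well-defined for all $y\le z$ and all $i$; similarly $(x_i\vee y)\wedge_y z$ is well-defined for all $y\le z$ and all $i$.
   Context: A poset is bounded if it has unique minimum $\hat0$ and maximum $\hat1$. $x\vee y$, $x\wedge y$ denote least common upper bound / greatest common lower bound when they exist. For $w,z\ge y$, $w\wedge_y z$ is the greatest element of $\{u: y\le u\le w,\ u\le z\}$ if it exists; for $w,y\le z$, $w\vee^z y$ is the least element of $\{u: w,y\le u\le z\}$ if it exists. An edge-labelling (map from covering relations to $\mathbb Z$) is an EL-labelling if for all $y<z$ there is a unique unrefinable chain from $y$ to $z$ with weakly increasing labels (the increasing chain), and its label sequence lexicographically precedes those of all other unrefinable chains from $y$ to $z$. It is interpolating if for every $y\lessdot u\lessdot z$, either $\gamma(y,u)<\gamma(u,z)$, or the increasing chain $y=w_0\lessdot\cdots\lessdot w_r=z$ has strictly increasing labels with $\gamma(w_0,w_1)=\gamma(u,z)$ and $\gamma(w_{r-1},w_r)=\gamma(y,u)$. -}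

module Defs where

open import Data.Nat using (ℕ)
open import Data.Fin using (Fin)
open import Data.Fin.Properties using (_≟_)
open import Data.Integer as ℤ using (ℤ)
open import Data.List using (List; []; _∷_; head; last; deduplicate)
open import Data.List.Relation.Unary.Linked using (Linked)
open import Data.List.Relation.Binary.Lex.Strict using (Lex-<)
open import Data.Maybe using (just)
open import Data.Product using (Σ; _×_; _,_)
open import Data.Sum using (_⊎_)
open import Relation.Binary.Core using (Rel)
open import Relation.Binary.Structures using (IsPartialOrder)
open import Relation.Binary.PropositionalEquality using (_≡_; _≢_)
open import Relation.Nullary using (¬_)
open import Level using (0ℓ)

record FinitePoset : Set₁ where
  field
    N         : ℕ
    _≤_       : Rel (Fin N) 0ℓ
    isPartialOrder : IsPartialOrder _≡_ _≤_

module PosetNotions (P : FinitePoset) where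
  open FinitePoset P public

  El : Set
  El = Fin N

  _<_ : El → El → Set
  x < y = (x ≤ y) × (x ≢ y)

  _⋖_ : El → El → Set
  x ⋖ y = (x < y) × (∀ u → ¬ ((x < u) × (u < y)))

  IsMin : El → Set
  IsMin b = ∀ x → b ≤ x

  IsMax : El → Set
  IsMax t = ∀ x → x ≤ t

  data CovChain : El → El → List El → Set where
    single : ∀ {y} → CovChain y y (y ∷ [])
    step   : ∀ {y u z ws} → y ⋖ u → CovChain u z ws → CovChain y z (y ∷ ws)

  -- An edge-labelling is given as γ : El → El → ℤ, only its values on covers matter.
  module Labelling (γ : El → El → ℤ) where

    labels : List El → List ℤ
    labels []               = []
    labels (_ ∷ [])         = []
    labels (a ∷ (b ∷ ws))   = γ a b ∷ labels (b ∷ ws)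

    IncChain : El → El → List El → Set
    IncChain y z ws = CovChain y z ws × Linked ℤ._≤_ (labels ws)

    IsEL : Set
    IsEL = ∀ y z → y < z →
      Σ (List El) λ ws →
        IncChain y z ws
        × (∀ ws′ → IncChain y z ws′ → ws′ ≡ ws)
        × (∀ ws′ → CovChain y z ws′ → ws′ ≢ ws →
             Lex-< _≡_ ℤ._<_ (labels ws) (labels ws′))

    IsInterpolating : Set
    IsInterpolating = ∀ y u z → y ⋖ u → u ⋖ z →
      (γ y u ℤ.< γ u z)
      ⊎ (∀ ws → IncChain y z ws →
           Linked ℤ._<_ (labels ws)
           × head (labels ws) ≡ just (γ u z)
           × last (labels ws) ≡ just (γ y u))

  IsMeet : El → El → El → Set
  IsMeet a b m = (m ≤ a) × (m ≤ b) × (∀ u → u ≤ a → u ≤ b → u ≤ m)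

  IsJoin : El → El → El → Set
  IsJoin a b j = (a ≤ j) × (b ≤ j) × (∀ u → a ≤ u → b ≤ u → j ≤ u)

  -- w ∧_y z = m : greatest element of {u : y ≤ u ≤ w, u ≤ z}
  IsRelMeet : (w y z m : El) → Set
  IsRelMeet w y z m = ((y ≤ m) × (m ≤ w) × (m ≤ z))
    × (∀ u → y ≤ u → u ≤ w → u ≤ z → u ≤ m)

  -- w ∨^z y = j : least element of {u : w, y ≤ u ≤ z}
  IsRelJoin : (w y z j : El) → Set
  IsRelJoin w y z j = ((w ≤ j) × (y ≤ j) × (j ≤ z))
    × (∀ u → w ≤ u → y ≤ u → u ≤ z → j ≤ u)

  dedup : List El → List El
  dedup = deduplicate _≟_

-- Interpolation makes every increasing chain strictly increasing. Its key consequence: each label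
-- of an unrefinable chain from y to u occurs on the increasing chain from y to u, and each label of
-- the latter lies between two labels of the former. Hence, for a threshold θ, the increasing chain
-- from b to t splits at a unique p into a part with labels ≤ θ and a part with labels > θ, and
-- whether u ≤ p (or p ≤ u) can be read off the labels of the increasing chain from b to u (or from
-- u to t). So the split point at θ of the chain from b to z is p ∧_b z, and dually for relative
-- joins. Each xᵢ is the split point of the chain from 0̂ to 1̂ at its own label γ(xᵢ₋₁, xᵢ), so
-- xᵢ ∧ z is the split point at that label of the increasing chain from 0̂ to z. The labels of that
-- chain are among those of the xᵢ, so these split points advance one cover at a time and sweep out
-- the whole chain.
module Submission where

open import Defs
open import Data.Integer using (ℤ)
open import Data.List using (List)
open import Data.List.Membership.Propositional using (_∈_)
open import Data.List.Relation.Binary.Pointwise using (Pointwise)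
open import Data.List.Relation.Unary.Linked using (Linked)
open import Data.Product using (Σ; _×_)

import Data.Integer as ℤ
import Data.Integer.Properties as ℤₚ
open import Data.Empty using (⊥-elim)
open import Data.Fin.Induction using (spo-wellFounded; po-noetherian)
open import Data.Fin.Properties using (_≟_)
open import Data.List using ([]; _∷_; _++_; map; head; last)
open import Data.List.Properties
  using (filter-all; filter-reject; filter-idem; map-cong-local; ∷-injectiveʳ)
open import Data.List.Membership.Propositional using (find; lose)
open import Data.List.Membership.Propositional.Properties using (∈-++⁺ˡ; ∈-++⁺ʳ; ∈-++⁻)
open import Data.List.Relation.Binary.Pointwise as Pointwise using ([]; _∷_)
open import Data.List.Relation.Binary.Subset.Propositional using (_⊆_)
import Data.List.Relation.Binary.Subset.Propositional.Properties as ⊆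
open import Data.List.Relation.Unary.All as All using (All; []; _∷_)
import Data.List.Relation.Unary.All.Properties as Allₚ
open import Data.List.Relation.Unary.AllPairs using (AllPairs; []; _∷_)
import Data.List.Relation.Unary.AllPairs.Properties as AllPairsₚ
open import Data.List.Relation.Unary.Any as Any using (Any; here; there)
import Data.List.Relation.Unary.Any.Properties as Anyₚ
open import Data.List.Relation.Unary.Linked as Linked using ([]; [-]; _∷_)
open import Data.List.Relation.Unary.Linked.Properties
  using (AllPairs⇒Linked; Linked⇒AllPairs; Linked⇒All)
open import Data.List.Relation.Unary.Unique.Propositional using (Unique)
open import Data.Maybe using (just)
open import Data.Maybe.Properties using (just-injective)
open import Data.Product using (_,_; proj₁; proj₂; uncurry)
open import Data.Sum using (inj₁; inj₂)
open import Function using (id; flip; _∘_; _on_)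
open import Induction.WellFounded using (Acc; acc; WellFounded)
open import Relation.Binary.Bundles using (Preorder)
import Relation.Binary.Construct.On as On
open import Relation.Binary.Definitions using (Transitive)
open import Relation.Binary.Structures using (IsPartialOrder)
open import Relation.Binary.PropositionalEquality
  using (_≡_; _≢_; refl; sym; trans; cong; subst; subst₂; isEquivalence; module ≡-Reasoning)
import Relation.Binary.Reasoning.Preorder as PreorderReasoning
open import Relation.Nullary using (yes; no; ¬?)

module _ {A : Set} {R : A → A → Set} where

  Linked-∷ : ∀ {x xs} → All (R x) xs → Linked R xs → Linked R (x ∷ xs)
  Linked-∷ []      [] = [-]
  Linked-∷ (r ∷ _) l  = r ∷ l

  Linked-++⁺ : Transitive R → ∀ {xs ys} → Linked R xs → Linked R ys →
               All (λ x → All (R x) ys) xs → Linked R (xs ++ ys)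
  Linked-++⁺ trans lx ly cross = AllPairs⇒Linked
    (AllPairsₚ.++⁺ (Linked⇒AllPairs trans lx) (Linked⇒AllPairs trans ly) cross)

module _ {A B : Set} {R : A → B → Set} where

  Pointwise-∈ : ∀ {xs ys x} → Pointwise R xs ys → x ∈ xs → Σ B (R x)
  Pointwise-∈ (r ∷ _)  (here refl) = _ , r
  Pointwise-∈ (_ ∷ rs) (there x∈)  = Pointwise-∈ rs x∈

  Pointwise-map-All : ∀ {S : A → B → Set} {Q : B → Set} {xs ys} →
                      (∀ {x y} → Q y → R x y → S x y) →
                      All Q ys → Pointwise R xs ys → Pointwise S xs ys
  Pointwise-map-All f []       []       = []
  Pointwise-map-All f (q ∷ qs) (r ∷ rs) = f q r ∷ Pointwise-map-All f qs rs

Pointwise-mapʳ : ∀ {A B C : Set} {R : A → C → Set} (f : B → C) {xs ys} →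
                 Pointwise (λ x y → R x (f y)) xs ys → Pointwise R xs (map f ys)
Pointwise-mapʳ f []       = []
Pointwise-mapʳ f (r ∷ rs) = r ∷ Pointwise-mapʳ f rs

∈-∷⇒∈-tail : ∀ {k l ks} → k ℤ.< l → l ∈ k ∷ ks → l ∈ ks
∈-∷⇒∈-tail k<l (here refl) = ⊥-elim (ℤₚ.<-irrefl refl k<l)
∈-∷⇒∈-tail k<l (there l∈)  = l∈

last-∈ : ∀ {xs : List ℤ} {a} → last xs ≡ just a → a ∈ xs
last-∈ {x ∷ []}     refl = here refl
last-∈ {x ∷ y ∷ xs} eq   = there (last-∈ {y ∷ xs} eq)

Linked-≤-last : ∀ {xs a} → Linked ℤ._≤_ xs → last xs ≡ just a → All (ℤ._≤ a) xs
Linked-≤-last {x ∷ []}     _         refl = ℤₚ.≤-refl ∷ []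
Linked-≤-last {x ∷ y ∷ xs} (x≤y ∷ l) eq   =
  let y∷xs≤a = Linked-≤-last l eq in ℤₚ.≤-trans x≤y (All.head y∷xs≤a) ∷ y∷xs≤a

Hull : List ℤ → ℤ → Set
Hull A l = Any (ℤ._≤ l) A × Any (l ℤ.≤_) A

infix 4 _⊑_
_⊑_ : List ℤ → List ℤ → Set
A ⊑ B = A ⊆ B × (∀ {l} → l ∈ B → Hull A l)

⊑-reflexive : ∀ {A B} → A ≡ B → A ⊑ B
⊑-reflexive refl = id , λ l∈ → lose l∈ ℤₚ.≤-refl , lose l∈ ℤₚ.≤-refl

⊑-trans : ∀ {A B C} → A ⊑ B → B ⊑ C → A ⊑ C
⊑-trans {A} {B} {C} (A⊆B , B⊆hullA) (B⊆C , C⊆hullB) = B⊆C ∘ A⊆B , hull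
  where
  hull : ∀ {l} → l ∈ C → Hull A l
  hull l∈ =
    let below , above   = C⊆hullB l∈
        b , b∈ , b≤l    = find below
        b′ , b′∈ , l≤b′ = find above
    in Any.map (λ a≤b → ℤₚ.≤-trans a≤b b≤l) (proj₁ (B⊆hullA b∈)) ,
       Any.map (ℤₚ.≤-trans l≤b′) (proj₂ (B⊆hullA b′∈))

⊑-preorder : Preorder _ _ _
⊑-preorder = record
  { isPreorder = record
    { isEquivalence = isEquivalence ; reflexive = ⊑-reflexive ; trans = ⊑-trans } }

module ⊑-Reasoning = PreorderReasoning ⊑-preorder

⊑-++ : ∀ {A₁ A₂ B₁ B₂} → A₁ ⊑ B₁ → A₂ ⊑ B₂ → A₁ ++ A₂ ⊑ B₁ ++ B₂
⊑-++ {A₁} {A₂} {B₁} {B₂} (A₁⊆B₁ , hull₁) (A₂⊆B₂ , hull₂) =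
  ⊆.++⁺ A₁⊆B₁ A₂⊆B₂ , hull
  where
  hull : ∀ {l} → l ∈ B₁ ++ B₂ → Hull (A₁ ++ A₂) l
  hull l∈ with ∈-++⁻ B₁ l∈
  ... | inj₁ l∈B₁ = let below , above = hull₁ l∈B₁ in
                    Anyₚ.++⁺ˡ below , Anyₚ.++⁺ˡ above
  ... | inj₂ l∈B₂ = let below , above = hull₂ l∈B₂ in
                    Anyₚ.++⁺ʳ A₁ below , Anyₚ.++⁺ʳ A₁ above

⊑-∷ : ∀ {x A B} → A ⊑ B → x ∷ A ⊑ x ∷ B
⊑-∷ = ⊑-++ (⊑-reflexive refl)

endpoints-⊑ : ∀ {L a b} → Linked ℤ._≤_ L → head L ≡ just b → last L ≡ just a →
              a ∷ b ∷ [] ⊑ L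
endpoints-⊑ {b ∷ L} {a} sorted refl final = endpoints⊆ , hull
  where
  endpoints⊆ : a ∷ b ∷ [] ⊆ b ∷ L
  endpoints⊆ (here refl)         = last-∈ final
  endpoints⊆ (there (here refl)) = here refl
  hull : ∀ {l} → l ∈ b ∷ L → Hull (a ∷ b ∷ []) l
  hull l∈ = there (here (All.lookup (Linked⇒All ℤₚ.≤-trans ℤₚ.≤-refl sorted) l∈)) ,
            here (All.lookup (Linked-≤-last sorted final) l∈)

module Chains (P : FinitePoset) (γ : PosetNotions.El P → PosetNotions.El P → ℤ) where
  open PosetNotions P
  open Labelling γ
  open IsPartialOrder isPartialOrder using ()
    renaming (refl to ≤-refl; trans to ≤-trans; antisym to ≤-antisym)

  private variable
    b c d p t u x x′ y z m m′ : El
    ws vs vp vq xs : List El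
    θ : ℤ

  CovChain⇒≤ : CovChain y z ws → y ≤ z
  CovChain⇒≤ single         = ≤-refl
  CovChain⇒≤ (step y⋖u ch) = ≤-trans (proj₁ (proj₁ y⋖u)) (CovChain⇒≤ ch)

  CovChain-∷ : CovChain y z ws → Σ (List El) λ vs → ws ≡ y ∷ vs
  CovChain-∷ single     = [] , refl
  CovChain-∷ (step _ _) = _ , refl

  CovChain-refl : CovChain y y ws → ws ≡ y ∷ []
  CovChain-refl single                       = refl
  CovChain-refl (step ((y≤u , y≢u) , _) ch) = ⊥-elim (y≢u (≤-antisym y≤u (CovChain⇒≤ ch)))

  CovChain⇒Linked : CovChain y z ws → Linked _≤_ ws
  CovChain⇒Linked single                                = [-]
  CovChain⇒Linked (step ((y≤u , _) , _) single)         = y≤u ∷ [-]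
  CovChain⇒Linked (step ((y≤u , _) , _) ch@(step _ _)) = y≤u ∷ CovChain⇒Linked ch

  CovChain⇒All-≥ : CovChain y z ws → All (y ≤_) ws
  CovChain⇒All-≥ single                     = ≤-refl ∷ []
  CovChain⇒All-≥ (step ((y≤u , _) , _) ch) =
    ≤-refl ∷ All.map (≤-trans y≤u) (CovChain⇒All-≥ ch)

  CovChain⇒Unique : CovChain y z ws → Unique ws
  CovChain⇒Unique single                       = [] ∷ []
  CovChain⇒Unique (step ((y≤u , y≢u) , _) ch) =
    All.map (λ { u≤w refl → y≢u (≤-antisym y≤u u≤w) }) (CovChain⇒All-≥ ch) ∷
    CovChain⇒Unique ch

  infixr 5 _⁀_
  _⁀_ : List El → List El → List El
  []            ⁀ vs = vs
  (_ ∷ [])      ⁀ vs = vs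
  (w ∷ w′ ∷ ws) ⁀ vs = w ∷ (w′ ∷ ws) ⁀ vs

  ⁀-∷ : CovChain c t ws → (y ∷ ws) ⁀ vs ≡ y ∷ ws ⁀ vs
  ⁀-∷ single     = refl
  ⁀-∷ (step _ _) = refl

  ⁀-CovChain : CovChain b c ws → CovChain c t vs → CovChain b t (ws ⁀ vs)
  ⁀-CovChain single                    ch′ = ch′
  ⁀-CovChain (step b⋖d single)         ch′ = step b⋖d ch′
  ⁀-CovChain (step b⋖d ch@(step _ _)) ch′ = step b⋖d (⁀-CovChain ch ch′)

  labels-∷ : CovChain c t ws → labels (y ∷ ws) ≡ γ y c ∷ labels ws
  labels-∷ single     = refl
  labels-∷ (step _ _) = refl

  labels-⁀ : CovChain b c ws → CovChain c t vs → labels (ws ⁀ vs) ≡ labels ws ++ labels vs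
  labels-⁀ single                          _   = refl
  labels-⁀ (step _ single)                 ch′ = labels-∷ ch′
  labels-⁀ (step {y = y} _ ch@(step _ _)) ch′ =
    trans (labels-∷ (⁀-CovChain ch ch′)) (cong (γ y _ ∷_) (labels-⁀ ch ch′))

  relMeet⇒meet : IsMin b → IsRelMeet x b z m → IsMeet x z m
  relMeet⇒meet isMin ((_ , m≤x , m≤z) , greatest) =
    m≤x , m≤z , λ u u≤x u≤z → greatest u (isMin u) u≤x u≤z

  relJoin⇒join : IsMax t → IsRelJoin x y t m → IsJoin x y m
  relJoin⇒join isMax ((x≤j , y≤j , _) , least) =
    x≤j , y≤j , λ u x≤u y≤u → least u x≤u y≤u (isMax u)

  meet-mono : IsMeet x z m → IsMeet x′ z m′ → x ≤ x′ → m ≤ m′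
  meet-mono (m≤x , m≤z , _) (_ , _ , greatest) x≤x′ = greatest _ (≤-trans m≤x x≤x′) m≤z

  meets-Linked : ∀ {ms} → Pointwise (λ x m → IsMeet x z m) xs ms →
                 Linked _≤_ xs → Linked _≤_ ms
  meets-Linked []                   []         = []
  meets-Linked (_ ∷ [])             [-]        = [-]
  meets-Linked (mt ∷ mts@(mt′ ∷ _)) (x≤x′ ∷ l) = meet-mono mt mt′ x≤x′ ∷ meets-Linked mts l

  cut : ℤ → El → List El → El
  cut θ c []       = c
  cut θ c (d ∷ ws) with γ c d ℤₚ.≤? θ
  ... | yes _ = cut θ d ws
  ... | no  _ = c

  cut-≤ : γ c d ℤ.≤ θ → cut θ c (d ∷ ws) ≡ cut θ d ws
  cut-≤ {c = c} {d = d} {θ = θ} γcd≤θ with γ c d ℤₚ.≤? θ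
  ... | yes _    = refl
  ... | no γcd≰θ = ⊥-elim (γcd≰θ γcd≤θ)

  cut-> : θ ℤ.< γ c d → cut θ c (d ∷ ws) ≡ c
  cut-> {θ = θ} {c = c} {d = d} θ<γcd with γ c d ℤₚ.≤? θ
  ... | yes γcd≤θ = ⊥-elim (ℤₚ.<⇒≱ θ<γcd γcd≤θ)
  ... | no _      = refl

  cut-below : All (θ ℤ.<_) (labels (c ∷ ws)) → cut θ c ws ≡ c
  cut-below {ws = []}    _           = refl
  cut-below {ws = _ ∷ _} (θ<γcd ∷ _) = cut-> θ<γcd

  cut-at-labels : AllPairs ℤ._<_ (labels (c ∷ ws)) →
                  Pointwise (λ x θ → cut θ c ws ≡ x) ws (labels (c ∷ ws))
  cut-at-labels {ws = []}    _               = []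
  cut-at-labels {ws = d ∷ _} (γcd< ∷ sorted) =
    trans (cut-≤ ℤₚ.≤-refl) (cut-below γcd<) ∷
    Pointwise-map-All (λ γcd<θ → trans (cut-≤ (ℤₚ.<⇒≤ γcd<θ))) γcd< (cut-at-labels sorted)

  cut-onto : AllPairs ℤ._<_ (labels (c ∷ ws)) → x ∈ c ∷ ws → Σ ℤ λ θ → cut θ c ws ≡ x
  cut-onto {ws = []}        _      (here refl) = ℤ.0ℤ , refl
  cut-onto {c} {ws = d ∷ _} _      (here refl) =
    ℤ.pred (γ c d) , cut-> (ℤₚ.i≤pred[j]⇒i<j ℤₚ.≤-refl)
  cut-onto                  sorted (there x∈)  = Pointwise-∈ (cut-at-labels sorted) x∈

  ⁀-cut : CovChain b p vp → CovChain p t vq →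
          All (ℤ._≤ θ) (labels vp) → All (θ ℤ.<_) (labels vq) →
          vp ⁀ vq ≡ b ∷ ws → cut θ b ws ≡ p
  ⁀-cut single _ _ above refl = cut-below above
  ⁀-cut {b = b} {p = p} {vq = vq} {θ = θ} {ws = ws}
        (step {u = c} {ws = vp} b⋖c cp) cq below above eq with CovChain-∷ (⁀-CovChain cp cq)
  ... | ws′ , glued≡ = begin
      cut θ b ws        ≡⟨ cong (cut θ b) (trans (sym tail≡) glued≡) ⟩
      cut θ b (c ∷ ws′) ≡⟨ cut-≤ (All.head below′) ⟩
      cut θ c ws′       ≡⟨ ⁀-cut cp cq (All.tail below′) above glued≡ ⟩
      p                 ∎
    where
    open ≡-Reasoning
    below′ : All (ℤ._≤ θ) (γ b c ∷ labels vp)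
    below′ = subst (All (ℤ._≤ θ)) (labels-∷ cp) below
    tail≡ : vp ⁀ vq ≡ ws
    tail≡ = ∷-injectiveʳ (trans (sym (⁀-∷ cp)) eq)

  cuts : List ℤ → El → List El → List El
  cuts θs c ws = map (λ θ → cut θ c ws) θs

  cuts-∷-≤ : ∀ {θs} → All (γ c d ℤ.≤_) θs → cuts θs c (d ∷ ws) ≡ cuts θs d ws
  cuts-∷-≤ = map-cong-local ∘ All.map cut-≤

  dedup-∷-∷ : ∀ x xs → dedup (x ∷ x ∷ xs) ≡ dedup (x ∷ xs)
  dedup-∷-∷ x xs = cong (x ∷_) (trans (filter-reject (¬? ∘ (x ≟_)) (λ x≢x → x≢x refl))
                                      (filter-idem (¬? ∘ (x ≟_)) (dedup xs)))

  dedup-∷ : ∀ {x xs ys} → dedup xs ≡ ys → All (x ≢_) ys → dedup (x ∷ xs) ≡ x ∷ ys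
  dedup-∷ {x} refl x∉ = cong (x ∷_) (filter-all (¬? ∘ (x ≟_)) x∉)

  -- Every label of c ∷ ws is a threshold, so consecutive thresholds enclose at most one of them:
  -- the cuts advance by at most one element at a time, and the last one is the end of c ∷ ws.
  dedup-cuts : ∀ {θs} → Unique (c ∷ ws) → AllPairs ℤ._<_ (labels (c ∷ ws)) →
               AllPairs ℤ._<_ θs → labels (c ∷ ws) ⊆ θs → dedup (c ∷ cuts θs c ws) ≡ c ∷ ws
  dedup-cuts {ws = []}    {[]} _ _ _ _ = refl
  dedup-cuts {ws = _ ∷ _} {[]} _ _ _ labels⊆ with labels⊆ (here refl)
  ... | ()
  dedup-cuts {c} {[]} {_ ∷ θs} uniq sorted (_ ∷ θs-sorted) _ =
    trans (dedup-∷-∷ c (cuts θs c [])) (dedup-cuts uniq sorted θs-sorted (λ ()))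
  dedup-cuts {c} {d ∷ ws} {θ ∷ θs} uniq@(c∉ ∷ uniq′) sorted@(γcd< ∷ sorted′) (θ< ∷ θs-sorted)
             labels⊆ with labels⊆ (here refl)
  ... | here refl = begin
      dedup (c ∷ cuts (θ ∷ θs) c (d ∷ ws))
        ≡⟨ cong (dedup ∘ (c ∷_)) (cuts-∷-≤ (ℤₚ.≤-refl ∷ All.map ℤₚ.<⇒≤ θ<)) ⟩
      dedup (c ∷ cut θ d ws ∷ cuts θs d ws)
        ≡⟨ cong (λ x → dedup (c ∷ x ∷ cuts θs d ws)) (cut-below γcd<) ⟩
      dedup (c ∷ d ∷ cuts θs d ws)
        ≡⟨ dedup-∷ {xs = d ∷ cuts θs d ws} (dedup-cuts uniq′ sorted′ θs-sorted labels⊆′) c∉ ⟩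
      c ∷ d ∷ ws ∎
    where
    open ≡-Reasoning
    labels⊆′ : labels (d ∷ ws) ⊆ θs
    labels⊆′ l∈ = ∈-∷⇒∈-tail (All.lookup γcd< l∈) (labels⊆ (there l∈))
  ... | there γcd∈θs = begin
      dedup (c ∷ cut θ c (d ∷ ws) ∷ cuts θs c (d ∷ ws))
        ≡⟨ cong (λ x → dedup (c ∷ x ∷ cuts θs c (d ∷ ws))) (cut-> θ<γcd) ⟩
      dedup (c ∷ c ∷ cuts θs c (d ∷ ws))
        ≡⟨ dedup-∷-∷ c (cuts θs c (d ∷ ws)) ⟩
      dedup (c ∷ cuts θs c (d ∷ ws))
        ≡⟨ dedup-cuts uniq sorted θs-sorted labels⊆′ ⟩
      c ∷ d ∷ ws ∎
    where
    open ≡-Reasoning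
    θ<γcd : θ ℤ.< γ c d
    θ<γcd = All.lookup θ< γcd∈θs
    labels⊆′ : labels (c ∷ d ∷ ws) ⊆ θs
    labels⊆′ l∈ = ∈-∷⇒∈-tail
      (ℤₚ.<-≤-trans θ<γcd (All.lookup (ℤₚ.≤-refl ∷ All.map ℤₚ.<⇒≤ γcd<) l∈)) (labels⊆ l∈)

  module Interpolating (isEL : IsEL) (interp : IsInterpolating) where

    incChain : y ≤ z → Σ (List El) λ ws → IncChain y z (y ∷ ws)
    incChain {y} {z} y≤z with y ≟ z
    ... | yes refl = [] , single , []
    ... | no y≢z with isEL y z (y≤z , y≢z)
    ...   | ws , ic , _ with CovChain-∷ (proj₁ ic)
    ...     | vs , refl = vs , ic

    incChain-unique : IncChain y z ws → IncChain y z vs → ws ≡ vs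
    incChain-unique {y} {z} ic ic′ with y ≟ z
    ... | yes refl = trans (CovChain-refl (proj₁ ic)) (sym (CovChain-refl (proj₁ ic′)))
    ... | no y≢z   = let _ , _ , unique , _ = isEL y z (CovChain⇒≤ (proj₁ ic) , y≢z)
                     in trans (unique _ ic) (sym (unique _ ic′))

    ascent-strict : y ⋖ u → u ⋖ z → γ y u ℤ.≤ γ u z → γ y u ℤ.< γ u z
    ascent-strict y⋖u u⋖z ascent with interp _ _ _ y⋖u u⋖z
    ... | inj₁ strict   = strict
    ... | inj₂ reversal =
      Linked.head (proj₁ (reversal _ (step y⋖u (step u⋖z single) , ascent ∷ [-])))

    incChain-strict : IncChain y z ws → Linked ℤ._<_ (labels ws)
    incChain-strict = uncurry strict
      where
      strict : CovChain y z ws → Linked ℤ._≤_ (labels ws) → Linked ℤ._<_ (labels ws)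
      strict single                                _                 = []
      strict (step _ single)                       _                 = [-]
      strict (step y⋖u ch@(step u⋖v single))     (ascent ∷ sorted) =
        ascent-strict y⋖u u⋖v ascent ∷ strict ch sorted
      strict (step y⋖u ch@(step u⋖v (step _ _))) (ascent ∷ sorted) =
        ascent-strict y⋖u u⋖v ascent ∷ strict ch sorted

    incChain-sorted : IncChain y z ws → AllPairs ℤ._<_ (labels ws)
    incChain-sorted = Linked⇒AllPairs ℤₚ.<-trans ∘ incChain-strict

    private
      ascending-wf : WellFounded (flip _<_)
      ascending-wf = po-noetherian isPartialOrder

      label-wf : ∀ y → WellFounded (ℤ._<_ on γ y)
      label-wf y = spo-wellFounded (On.isStrictPartialOrder (γ y) ℤₚ.<-isStrictPartialOrder)

      ∷-⊑-∷ : ∀ {u′} → CovChain c u ws → CovChain c u′ vs → labels ws ⊑ labels vs →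
              labels (y ∷ ws) ⊑ labels (y ∷ vs)
      ∷-⊑-∷ {y = y} ch ch′ =
        subst₂ _⊑_ (sym (labels-∷ {y = y} ch)) (sym (labels-∷ {y = y} ch′)) ∘ ⊑-∷

      -- Induction on y from the top of the poset and, for fixed y, on the label γ y c of the first
      -- cover. A descent y ⋖ c ⋖ d is replaced by the increasing chain from y to d, whose labels
      -- run strictly from γ c d up to γ y c; its first label γ c d is smaller than γ y c.
      mutual
        ⊑-incChain : Acc (flip _<_) y → CovChain y u ws → IncChain y u vs →
                     labels ws ⊑ labels vs
        ⊑-incChain _ single ic = ⊑-reflexive (cong labels (sym (CovChain-refl (proj₁ ic))))
        ⊑-incChain acc-y@(acc above) (step y⋖c ch) ic =
          let _ , icc = incChain (CovChain⇒≤ ch)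
          in ⊑-trans (∷-⊑-∷ ch (proj₁ icc) (⊑-incChain (above (proj₁ y⋖c)) ch icc))
                     (cover∷inc-⊑-inc acc-y (label-wf _ _) y⋖c icc ic)

        cover∷inc-⊑-inc : Acc (flip _<_) y → Acc (ℤ._<_ on γ y) c → y ⋖ c →
                          IncChain c u vp → IncChain y u vs → labels (y ∷ vp) ⊑ labels vs
        cover∷inc-⊑-inc _ _ y⋖c (single , _) ic =
          ⊑-reflexive (cong labels (incChain-unique (step y⋖c single , [-]) ic))
        cover∷inc-⊑-inc {y = y} {c = c} acc-y acc-c y⋖c (step {u = d} c⋖d ch , sorted) ic
          with CovChain-∷ ch | γ y c ℤₚ.≤? γ c d
        ... | _ , refl | yes ascent =
          ⊑-reflexive (cong labels (incChain-unique (step y⋖c (step c⋖d ch) , ascent ∷ sorted) ic))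
        ... | _ , refl | no descent with interp y c d y⋖c c⋖d
        ...   | inj₁ γyc<γcd = ⊥-elim (descent (ℤₚ.<⇒≤ γyc<γcd))
        ...   | inj₂ reversal =
          let _ , icf                = incChain (≤-trans (proj₁ (proj₁ y⋖c)) (proj₁ (proj₁ c⋖d)))
              strict , first , final = reversal _ icf
          in descent-⊑-inc acc-y acc-c y⋖c c⋖d ch ic (ℤₚ.≰⇒> descent)
                           (proj₁ icf) strict first final

        descent-⊑-inc : ∀ {r fs} → Acc (flip _<_) y → Acc (ℤ._<_ on γ y) c → y ⋖ c → c ⋖ d →
                        CovChain d u r → IncChain y u vs → γ c d ℤ.< γ y c →
                        CovChain y d fs → Linked ℤ._<_ (labels fs) →
                        head (labels fs) ≡ just (γ c d) → last (labels fs) ≡ just (γ y c) →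
                        labels (y ∷ c ∷ r) ⊑ labels vs
        descent-⊑-inc _ _ _ _ _ _ _ single _ () _
        descent-⊑-inc {y = y} {c = c} {d = d} {u = u} {vs = vs} {r = r}
                      acc-y@(acc above) (acc smaller) y⋖c c⋖d ch ic γcd<γyc
                      (step {u = e} {ws = fs} y⋖e fch) strict first final = begin
          labels (y ∷ c ∷ r)          ≡⟨ cong (γ y c ∷_) (labels-∷ ch) ⟩
          γ y c ∷ γ c d ∷ labels r    ≲⟨ ⊑-++ (endpoints-⊑ (Linked.map ℤₚ.<⇒≤ strict) first final)
                                              (⊑-reflexive refl) ⟩
          labels (y ∷ fs) ++ labels r ≡⟨ labels-⁀ (step y⋖e fch) ch ⟨
          labels ((y ∷ fs) ⁀ r)       ≡⟨ cong labels (⁀-∷ fch) ⟩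
          labels (y ∷ fs ⁀ r)         ≲⟨ ∷-⊑-∷ e→u (proj₁ ice) (⊑-incChain (above (proj₁ y⋖e)) e→u ice) ⟩
          labels (y ∷ e ∷ ve)         ≲⟨ cover∷inc-⊑-inc acc-y (smaller γye<γyc) y⋖e ice ic ⟩
          labels vs                   ∎
          where
          open ⊑-Reasoning
          e→u : CovChain e u (fs ⁀ r)
          e→u = ⁀-CovChain fch ch
          ve : List El
          ve = proj₁ (incChain (CovChain⇒≤ e→u))
          ice : IncChain e u (e ∷ ve)
          ice = proj₂ (incChain (CovChain⇒≤ e→u))
          γye<γyc : γ y e ℤ.< γ y c
          γye<γyc = subst (ℤ._< γ y c)
                          (just-injective (trans (sym first) (cong head (labels-∷ fch)))) γcd<γyc

    labels-⊑-incChain : CovChain y u ws → IncChain y u vs → labels ws ⊑ labels vs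
    labels-⊑-incChain = ⊑-incChain (ascending-wf _)

    subchain-labels-⊆ : ∀ {y′ z′} → y ≤ y′ → z′ ≤ z → CovChain y′ z′ ws → IncChain y z vs →
                        labels ws ⊆ labels vs
    subchain-labels-⊆ {y} {z} {ws} {y′ = y′} {z′} y≤y′ z′≤z ch ic {l} l∈ =
      proj₁ (labels-⊑-incChain whole ic)
        (subst (l ∈_) (sym whole-labels) (∈-++⁺ʳ (labels (y ∷ pre)) (∈-++⁺ˡ l∈)))
      where
      pre : List El
      pre = proj₁ (incChain y≤y′)
      post : List El
      post = proj₁ (incChain z′≤z)
      y→y′ : CovChain y y′ (y ∷ pre)
      y→y′ = proj₁ (proj₂ (incChain y≤y′))
      z′→z : CovChain z′ z (z′ ∷ post)
      z′→z = proj₁ (proj₂ (incChain z′≤z))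
      whole : CovChain y z ((y ∷ pre) ⁀ ws ⁀ (z′ ∷ post))
      whole = ⁀-CovChain y→y′ (⁀-CovChain ch z′→z)
      whole-labels : labels ((y ∷ pre) ⁀ ws ⁀ (z′ ∷ post)) ≡
                     labels (y ∷ pre) ++ labels ws ++ labels (z′ ∷ post)
      whole-labels = trans (labels-⁀ y→y′ (⁀-CovChain ch z′→z))
                           (cong (labels (y ∷ pre) ++_) (labels-⁀ ch z′→z))

    incChain-labels-≤ : CovChain y u ws → IncChain y u vs →
                        All (ℤ._≤ θ) (labels ws) → All (ℤ._≤ θ) (labels vs)
    incChain-labels-≤ ch ic ws≤θ = All.tabulate λ l∈ →
      let k , k∈ , l≤k = find (proj₂ (proj₂ (labels-⊑-incChain ch ic) l∈))
      in ℤₚ.≤-trans l≤k (All.lookup ws≤θ k∈)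

    incChain-labels-> : CovChain y u ws → IncChain y u vs →
                        All (θ ℤ.<_) (labels ws) → All (θ ℤ.<_) (labels vs)
    incChain-labels-> ch ic θ<ws = All.tabulate λ l∈ →
      let k , k∈ , k≤l = find (proj₁ (proj₂ (labels-⊑-incChain ch ic) l∈))
      in ℤₚ.<-≤-trans (All.lookup θ<ws k∈) k≤l

    record Split (θ : ℤ) (b t p : El) : Set where
      field
        {lower upper} : List El
        lower-inc     : IncChain b p lower
        upper-inc     : IncChain p t upper
        lower-≤       : All (ℤ._≤ θ) (labels lower)
        upper->       : All (θ ℤ.<_) (labels upper)

    Split⇒IncChain : (sp : Split θ b t p) → IncChain b t (Split.lower sp ⁀ Split.upper sp)
    Split⇒IncChain sp =
      ⁀-CovChain (proj₁ lower-inc) (proj₁ upper-inc) ,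
      subst (Linked ℤ._≤_) (sym (labels-⁀ (proj₁ lower-inc) (proj₁ upper-inc)))
        (Linked-++⁺ ℤₚ.≤-trans (proj₂ lower-inc) (proj₂ upper-inc)
          (All.map (λ l≤θ → All.map (ℤₚ.≤-trans l≤θ ∘ ℤₚ.<⇒≤) upper->) lower-≤))
      where open Split sp

    Split-≡-cut : Split θ b t p → IncChain b t (b ∷ ws) → p ≡ cut θ b ws
    Split-≡-cut sp ic = sym (⁀-cut (proj₁ lower-inc) (proj₁ upper-inc) lower-≤ upper->
                                   (incChain-unique (Split⇒IncChain sp) ic))
      where open Split sp

    Split-unique : ∀ {q} → Split θ b t p → Split θ b t q → p ≡ q
    Split-unique sp sq =
      let _ , ic = incChain (CovChain⇒≤ (proj₁ (Split⇒IncChain sp)))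
      in trans (Split-≡-cut sp ic) (sym (Split-≡-cut sq ic))

    Split-∷ : b ⋖ d → γ b d ℤ.≤ θ → IncChain d t vs → All (γ b d ℤ.≤_) (labels vs) →
              Split θ d t p → Split θ b t p
    Split-∷ {b} {d} b⋖d γbd≤θ ic bound sp = record
      { lower-inc = step b⋖d (proj₁ lower-inc) ,
                    subst (Linked ℤ._≤_) (sym (labels-∷ (proj₁ lower-inc)))
                          (Linked-∷ lower-bound (proj₂ lower-inc))
      ; upper-inc = upper-inc
      ; lower-≤   = subst (All (ℤ._≤ _)) (sym (labels-∷ (proj₁ lower-inc))) (γbd≤θ ∷ lower-≤)
      ; upper->   = upper->
      }
      where
      open Split sp
      lower-bound : All (γ b d ℤ.≤_) (labels lower)
      lower-bound = All.tabulate λ l∈ → All.lookup bound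
        (subst (_ ∈_) (trans (sym (labels-⁀ (proj₁ lower-inc) (proj₁ upper-inc)))
                             (cong labels (incChain-unique (Split⇒IncChain sp) ic)))
                      (∈-++⁺ˡ l∈))

    cut-Split : IncChain b t (b ∷ ws) → Split θ b t (cut θ b ws)
    cut-Split (single , _) =
      record { lower-inc = single , [] ; upper-inc = single , [] ; lower-≤ = [] ; upper-> = [] }
    cut-Split {b} {θ = θ} (step {u = d} b⋖d ch , sorted) with CovChain-∷ ch
    ... | _ , refl with γ b d ℤₚ.≤? θ
    ...   | yes γbd≤θ = Split-∷ b⋖d γbd≤θ (ch , Linked.tail sorted)
                          (All.tail (Linked⇒All ℤₚ.≤-trans ℤₚ.≤-refl sorted))
                          (cut-Split (ch , Linked.tail sorted))
    ...   | no γbd≰θ = record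
      { lower-inc = single , [] ; upper-inc = step b⋖d ch , sorted ; lower-≤ = []
      ; upper->   = All.map (ℤₚ.<-≤-trans (ℤₚ.≰⇒> γbd≰θ)) (Linked⇒All ℤₚ.≤-trans ℤₚ.≤-refl sorted) }

    Split-exists : ∀ θ → b ≤ t → Σ El (Split θ b t)
    Split-exists θ b≤t = let ws , ic = incChain b≤t in cut θ _ ws , cut-Split ic

    ≤-split⇒labels-≤ : Split θ b t p → u ≤ p → IncChain b u ws → All (ℤ._≤ θ) (labels ws)
    ≤-split⇒labels-≤ sp u≤p (ch , _) =
      All.tabulate λ l∈ → All.lookup lower-≤ (subchain-labels-⊆ ≤-refl u≤p ch lower-inc l∈)
      where open Split sp

    ≥-split⇒labels-> : Split θ b t p → p ≤ u → IncChain u t ws → All (θ ℤ.<_) (labels ws)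
    ≥-split⇒labels-> sp p≤u (ch , _) =
      All.tabulate λ l∈ → All.lookup upper-> (subchain-labels-⊆ p≤u ≤-refl ch upper-inc l∈)
      where open Split sp

    -- Splitting [u, t] at θ and prepending the chain from b to u gives a split of [b, t].
    labels-≤⇒≤-split : Split θ b t p → u ≤ t → IncChain b u ws → All (ℤ._≤ θ) (labels ws) →
                       u ≤ p
    labels-≤⇒≤-split {θ} {b} {t} {u = u} sp u≤t (ch , _) ws≤θ =
      subst (u ≤_) (Split-unique sq′ sp) (CovChain⇒≤ (proj₁ lower-inc))
      where
      q : El
      q = proj₁ (Split-exists θ u≤t)
      sq : Split θ u t q
      sq = proj₂ (Split-exists θ u≤t)
      open Split sq
      b→q : CovChain b q (_ ⁀ lower)
      b→q = ⁀-CovChain ch (proj₁ lower-inc)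
      icq : IncChain b q (b ∷ _)
      icq = proj₂ (incChain (CovChain⇒≤ b→q))
      sq′ : Split θ b t q
      sq′ = record
        { lower-inc = icq ; upper-inc = upper-inc ; upper-> = upper->
        ; lower-≤   = incChain-labels-≤ b→q icq
            (subst (All (ℤ._≤ θ)) (sym (labels-⁀ ch (proj₁ lower-inc))) (Allₚ.++⁺ ws≤θ lower-≤)) }

    labels->⇒≥-split : Split θ b t p → b ≤ u → IncChain u t ws → All (θ ℤ.<_) (labels ws) →
                       p ≤ u
    labels->⇒≥-split {θ} {b} {t} {u = u} sp b≤u (ch , _) θ<ws =
      subst (_≤ u) (Split-unique sq′ sp) (CovChain⇒≤ (proj₁ upper-inc))
      where
      q : El
      q = proj₁ (Split-exists θ b≤u)
      sq : Split θ b u q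
      sq = proj₂ (Split-exists θ b≤u)
      open Split sq
      q→t : CovChain q t (upper ⁀ _)
      q→t = ⁀-CovChain (proj₁ upper-inc) ch
      icq : IncChain q t (q ∷ _)
      icq = proj₂ (incChain (CovChain⇒≤ q→t))
      sq′ : Split θ b t q
      sq′ = record
        { lower-inc = lower-inc ; upper-inc = icq ; lower-≤ = lower-≤
        ; upper->   = incChain-labels-> q→t icq
            (subst (All (θ ℤ.<_)) (sym (labels-⁀ (proj₁ upper-inc) ch)) (Allₚ.++⁺ upper-> θ<ws)) }

    Split-relMeet : z ≤ t → Split θ b t p → Split θ b z m → IsRelMeet p b z m
    Split-relMeet {z} {b = b} {p} {m} z≤t sp sm = (b≤m , m≤p , m≤z) , greatest
      where
      open Split sm
      b≤m : b ≤ m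
      b≤m = CovChain⇒≤ (proj₁ lower-inc)
      m≤z : m ≤ z
      m≤z = CovChain⇒≤ (proj₁ upper-inc)
      m≤p : m ≤ p
      m≤p = labels-≤⇒≤-split sp (≤-trans m≤z z≤t) lower-inc lower-≤
      greatest : ∀ u → b ≤ u → u ≤ p → u ≤ z → u ≤ m
      greatest u b≤u u≤p u≤z =
        let _ , ic = incChain b≤u in labels-≤⇒≤-split sm u≤z ic (≤-split⇒labels-≤ sp u≤p ic)

    Split-relJoin : b ≤ y → Split θ b t p → Split θ y t m → IsRelJoin p y t m
    Split-relJoin {y = y} {t = t} {p = p} {m = j} b≤y sp sj = (p≤j , y≤j , j≤t) , least
      where
      open Split sj
      y≤j : y ≤ j
      y≤j = CovChain⇒≤ (proj₁ lower-inc)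
      j≤t : j ≤ t
      j≤t = CovChain⇒≤ (proj₁ upper-inc)
      p≤j : p ≤ j
      p≤j = labels->⇒≥-split sp (≤-trans b≤y y≤j) upper-inc upper->
      least : ∀ u → p ≤ u → y ≤ u → u ≤ t → j ≤ u
      least u p≤u y≤u u≤t =
        let _ , ic = incChain u≤t in labels->⇒≥-split sj y≤u ic (≥-split⇒labels-> sp p≤u ic)

    ∈-incChain⇒Split : IncChain b t (b ∷ ws) → x ∈ b ∷ ws → Σ ℤ λ θ → Split θ b t x
    ∈-incChain⇒Split ic x∈ =
      let θ , cut≡x = cut-onto (incChain-sorted ic) x∈
      in θ , subst (Split θ _ _) cut≡x (cut-Split ic)

    meets-incChain : IsMin b → IsMax t → IncChain b t (b ∷ xs) → ∀ z →
                     Σ (List El) λ ms → Pointwise (λ x m → IsMeet x z m) (b ∷ xs) ms ×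
                                        Linked _≤_ ms × IncChain b z (dedup ms)
    meets-incChain {b} {t} {xs} isMin isMax icx z =
      ms , meets , meets-Linked meets (CovChain⇒Linked (proj₁ icx)) ,
      subst (IncChain b z) (sym dedup-ms) icz
      where
      zs : List El
      zs = proj₁ (incChain (isMin z))
      icz : IncChain b z (b ∷ zs)
      icz = proj₂ (incChain (isMin z))
      ms : List El
      ms = b ∷ cuts (labels (b ∷ xs)) b zs
      meet-at : ∀ {x θ} → cut θ b xs ≡ x → IsMeet x z (cut θ b zs)
      meet-at {θ = θ} cut≡x = relMeet⇒meet isMin
        (Split-relMeet (isMax z) (subst (Split θ b t) cut≡x (cut-Split icx)) (cut-Split icz))
      meets : Pointwise (λ x m → IsMeet x z m) (b ∷ xs) ms
      meets = (≤-refl , isMin z , λ _ u≤b _ → u≤b) ∷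
              Pointwise-mapʳ (λ θ → cut θ b zs)
                (Pointwise.map meet-at (cut-at-labels (incChain-sorted icx)))
      dedup-ms : dedup ms ≡ b ∷ zs
      dedup-ms = dedup-cuts (CovChain⇒Unique (proj₁ icz)) (incChain-sorted icz)
                            (incChain-sorted icx) (subchain-labels-⊆ ≤-refl (isMax z) (proj₁ icz) icx)

    meet-relJoin : IsMin b → IsMax t → IncChain b t (b ∷ xs) → x ∈ b ∷ xs → y ≤ z →
                   Σ El λ m → IsMeet x z m × Σ El λ j → IsRelJoin m y z j
    meet-relJoin isMin isMax icx x∈ y≤z =
      let θ , sx = ∈-incChain⇒Split icx x∈
          m , sm = Split-exists θ (isMin _)
          j , sj = Split-exists θ y≤z
      in m , relMeet⇒meet isMin (Split-relMeet (isMax _) sx sm) , j , Split-relJoin (isMin _) sm sj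

    join-relMeet : IsMin b → IsMax t → IncChain b t (b ∷ xs) → x ∈ b ∷ xs → y ≤ z →
                   Σ El λ j → IsJoin x y j × Σ El λ m → IsRelMeet j y z m
    join-relMeet isMin isMax icx x∈ y≤z =
      let θ , sx = ∈-incChain⇒Split icx x∈
          j , sj = Split-exists θ (isMax _)
          m , sm = Split-exists θ y≤z
      in j , relJoin⇒join isMax (Split-relJoin (isMin _) sx sj) , m , Split-relMeet (isMax _) sj sm

lemma10 : (P : FinitePoset) → let open PosetNotions P in
    (bot top : El) → IsMin bot → IsMax top →
    (γ : El → El → ℤ) → let open Labelling γ in
    IsEL → IsInterpolating →
    (xs : List El) → IncChain bot top xs →
    (∀ z → Σ (List El) λ ms →
        Pointwise (λ x m → IsMeet x z m) xs ms
        × Linked _≤_ ms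
        × IncChain bot z (dedup ms))
    × (∀ x y z → x ∈ xs → y ≤ z →
        Σ El λ m → IsMeet x z m × Σ El λ j → IsRelJoin m y z j)
    × (∀ x y z → x ∈ xs → y ≤ z →
        Σ El λ j → IsJoin x y j × Σ El λ m → IsRelMeet j y z m)
lemma10 P bot top isMin isMax γ isEL interp xs icx with Chains.CovChain-∷ P γ (proj₁ icx)
... | _ , refl =
  meets-incChain isMin isMax icx ,
  (λ _ _ _ x∈ → meet-relJoin isMin isMax icx x∈) ,
  (λ _ _ _ x∈ → join-relMeet isMin isMax icx x∈)
  where
  open Chains P γ
  open Interpolating isEL interp
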